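{- Let $d\ge 2$ be an integer. Consider any greedy algorithm for $d$-Scattered Set of the following form: starting with all vertices of the input graph $G=(V,E)$ unconsidered and an empty solution, repeatedly choose an unconsidered vertex $v$ (according to any rule, e.g. based on vertex degrees), add $v$ to the solution, and mark $v$ together with all vertices at distance at most $d-1$ from $v$ in $G$ as considered, until no unconsidered vertices remain. Then on graphs of maximum degree at most $\Delta$ such an algorithm achieves approximation ratio $O(\Delta^{\lfloor d/2\rfloor})$, i.e. $OPT_d(G)\le ALG\cdot O(\Delta^{\lfloor d/2\rfloor})$, where $ALG$ is the size of the returned solution.
   Context: All graphs are finite, simple and undirected. $d_G(u,v)$ is the shortest-path distance (number of edges) between $u$ and $v$ in $G$. A $d$-scattered set of $G$ is a set $K\subseteq V$ with $d_G(u,v)\ge d$ for all distinct $u,v\in K$; $OPT_d(G)$ is the maximum size of a $d$-scattered set in $G$. -}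

module Defs where

open import Data.Nat using (ℕ; zero; suc; _∸_; _<_; _≤_)
open import Data.Fin using (Fin)
open import Data.Fin.Subset using (Subset; _∈_; ∣_∣)
open import Data.Vec using (tabulate)
open import Data.Bool using (Bool; true; false)
open import Data.List using (List; length; lookup)
open import Data.Product using (∃; _×_)
open import Relation.Nullary using (¬_)
open import Relation.Binary.PropositionalEquality using (_≡_)

record Graph (n : ℕ) : Set where
  field
    adj        : Fin n → Fin n → Bool
    adj-sym    : ∀ u v → adj u v ≡ adj v u
    adj-irrefl : ∀ v → adj v v ≡ false
open Graph public

module _ {n : ℕ} (G : Graph n) where

  degree : Fin n → ℕ
  degree v = ∣ tabulate (adj G v) ∣

  MaxDegreeAtMost : ℕ → Set
  MaxDegreeAtMost Δ = ∀ v → degree v ≤ Δ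

  -- DistAtMost k u v  ⇔  d_G(u,v) ≤ k  (there is a walk of length ≤ k from u to v)
  data DistAtMost : ℕ → Fin n → Fin n → Set where
    here : ∀ {k u} → DistAtMost k u u
    step : ∀ {k u w v} → adj G u w ≡ true → DistAtMost k w v → DistAtMost (suc k) u v

  Scattered : ℕ → Subset n → Set
  Scattered d K = ∀ u v → u ∈ K → v ∈ K → ¬ (u ≡ v) → ¬ DistAtMost (d ∸ 1) u v

  -- vs is the sequence of vertices chosen by a run of a greedy algorithm of the
  -- described form (for some choice rule): each chosen vertex vs[i] was still
  -- unconsidered, i.e. not within distance d-1 of any earlier chosen vs[j];
  -- and at termination no unconsidered vertex remains, i.e. every vertex is
  -- within distance d-1 of some chosen vertex.
  GreedyRun : ℕ → List (Fin n) → Set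
  GreedyRun d vs =
    (∀ (i j : Fin (length vs)) → Data.Fin._<_ j i →
        ¬ DistAtMost (d ∸ 1) (lookup vs j) (lookup vs i))
    × (∀ v → ∃ λ (i : Fin (length vs)) → DistAtMost (d ∸ 1) (lookup vs i) v)

module Submission where

-- Write d = e + 1, so "d-scattered" means "pairwise at distance > e".  When a
-- greedy run stops, every vertex lies within distance e of a chosen vertex, so
-- a scattered set K is covered by the radius-e balls around the chosen
-- vertices, and it suffices to bound ∣K ∩ ball e v∣ for every vertex v.  Split
-- e = ⌊e/2⌋ + ⌈e/2⌉ (and ⌈e/2⌉ = d/2 rounded down).
--   * Packing: a ball of radius ⌊e/2⌋ holds at most one point of K, since two
--     such points would be at distance ≤ 2⌊e/2⌋ ≤ e.
--   * Growth: a ball of radius m+1 is its centre together with the radius-m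
--     balls around the ≤ Δ neighbours, so ∣K ∩ ball (m+1) v∣ ≤ 1 + Δ·N whenever
--     every radius-m ball holds ≤ N points of K; with N = (1+Δ)^k this is
--     ≤ (1+Δ)^(k+1).
-- Hence ∣K∣ ≤ ALG · (1+Δ)^⌊d/2⌋ ≤ ALG · 2^⌊d/2⌋ · Δ^⌊d/2⌋ for Δ ≥ 1.

open import Defs
open import Data.Nat using (ℕ; _≤_; _*_; _^_; _/_)
open import Data.Fin.Subset using (Subset; ∣_∣)
open import Data.List using (List; length)
open import Data.Product using (∃)

open import Data.Nat using (zero; suc; _+_; _∸_; z≤n; s≤s; ⌊_/2⌋)
open import Data.Nat.Properties hiding (_≟_)
open import Data.Nat.DivMod using (m/n≡1+[m∸n]/n)
open import Algebra.Properties.CommutativeSemigroup *-commutativeSemigroup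
  using (interchange)
open import Data.Fin using (Fin; _≟_)
open import Data.Fin.Subset
  using (_∈_; _⊆_; _∪_; _∩_; ⊥; ⊤; ⁅_⁆; inside; outside)
open import Data.Fin.Subset.Properties
  using ( ∣p∣≤∣x∷p∣; ∉⊥; ∣⊥∣≡0; ∈⊤; ∣⊤∣≡n; x∈⁅x⁆; x∈⁅y⁆⇒x≡y; ∣⁅x⁆∣≡1
        ; p⊆q⇒∣p∣≤∣q∣; nonempty?; Empty-unique; ∩-zeroʳ; ∩-distribˡ-∪
        ; x∈p∩q⁺; x∈p∩q⁻; ∣p∩q∣≤∣q∣; x∈p∪q⁺; x∈p∪q⁻ )
open import Data.Vec using (_∷_; []; here; there; tabulate)
open import Data.Vec.Properties using (lookup∘tabulate; []=⇒lookup; lookup⇒[]=)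
import Data.List as List
open import Data.Bool using (true)
open import Data.Product using (_,_; _×_; proj₂)
open import Data.Sum using (inj₁; inj₂)
open import Data.Empty using (⊥-elim)
open import Function using (_∘_)
open import Relation.Nullary using (yes; no)
open import Relation.Nullary.Decidable using (decidable-stable)
open import Relation.Binary.PropositionalEquality

^-distribʳ-* : ∀ a b k → (a * b) ^ k ≡ a ^ k * b ^ k
^-distribʳ-* a b zero    = refl
^-distribʳ-* a b (suc k) =
  trans (cong (a * b *_) (^-distribʳ-* a b k)) (interchange a b (a ^ k) (b ^ k))

[1+Δ]^k≤2^k*Δ^k : ∀ {Δ} → 1 ≤ Δ → ∀ k → (1 + Δ) ^ k ≤ 2 ^ k * Δ ^ k
[1+Δ]^k≤2^k*Δ^k {Δ} 1≤Δ k = begin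
  (1 + Δ) ^ k    ≤⟨ ^-monoˡ-≤ k 1+Δ≤2*Δ ⟩
  (2 * Δ) ^ k    ≡⟨ ^-distribʳ-* 2 Δ k ⟩
  2 ^ k * Δ ^ k  ∎
  where
    open ≤-Reasoning
    1+Δ≤2*Δ : 1 + Δ ≤ 2 * Δ
    1+Δ≤2*Δ = ≤-trans (+-monoˡ-≤ Δ 1≤Δ) (≤-reflexive (cong (Δ +_) (sym (+-identityʳ Δ))))

n/2≡⌊n/2⌋ : ∀ n → n / 2 ≡ ⌊ n /2⌋
n/2≡⌊n/2⌋ zero          = refl
n/2≡⌊n/2⌋ (suc zero)    = refl
n/2≡⌊n/2⌋ (suc (suc n)) = trans (m/n≡1+[m∸n]/n {m = suc (suc n)} {n = 2} (s≤s (s≤s z≤n))) (cong suc (n/2≡⌊n/2⌋ n))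

radius-split : ∀ e → ⌊ e /2⌋ + suc e / 2 ≡ e
radius-split e = trans (cong (⌊ e /2⌋ +_) (n/2≡⌊n/2⌋ (suc e))) (⌊n/2⌋+⌈n/2⌉≡n e)

-- Two points within ⌊e/2⌋ of a common centre are within distance e.
packing-radius : ∀ e → ⌊ e /2⌋ + ⌊ e /2⌋ ≤ e
packing-radius e =
  ≤-trans (+-monoʳ-≤ ⌊ e /2⌋ (⌊n/2⌋≤⌈n/2⌉ e)) (≤-reflexive (⌊n/2⌋+⌈n/2⌉≡n e))

∣p∪q∣≤∣p∣+∣q∣ : ∀ {n} (p q : Subset n) → ∣ p ∪ q ∣ ≤ ∣ p ∣ + ∣ q ∣
∣p∪q∣≤∣p∣+∣q∣ []            []            = z≤n
∣p∪q∣≤∣p∣+∣q∣ (inside  ∷ p) (y       ∷ q) =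
  s≤s (≤-trans (∣p∪q∣≤∣p∣+∣q∣ p q) (+-monoʳ-≤ ∣ p ∣ (∣p∣≤∣x∷p∣ y q)))
∣p∪q∣≤∣p∣+∣q∣ (outside ∷ p) (inside  ∷ q) =
  ≤-trans (s≤s (∣p∪q∣≤∣p∣+∣q∣ p q)) (≤-reflexive (sym (+-suc ∣ p ∣ ∣ q ∣)))
∣p∪q∣≤∣p∣+∣q∣ (outside ∷ p) (outside ∷ q) = ∣p∪q∣≤∣p∣+∣q∣ p q

subsingleton⇒∣p∣≤1 : ∀ {n} (p : Subset n) →
  (∀ {x y} → x ∈ p → y ∈ p → x ≡ y) → ∣ p ∣ ≤ 1
subsingleton⇒∣p∣≤1 {n} p unique with nonempty? p
... | yes (x , x∈p) =
  ≤-trans (p⊆q⇒∣p∣≤∣q∣ p⊆⁅x⁆) (≤-reflexive (∣⁅x⁆∣≡1 x))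
  where
    p⊆⁅x⁆ : p ⊆ ⁅ x ⁆
    p⊆⁅x⁆ y∈p = subst (_∈ ⁅ x ⁆) (unique x∈p y∈p) (x∈⁅x⁆ x)
... | no empty =
  ≤-trans (≤-reflexive (trans (cong ∣_∣ (Empty-unique empty)) (∣⊥∣≡0 n))) z≤n

⋃[_]_ : ∀ {m n} → Subset m → (Fin m → Subset n) → Subset n
⋃[ []          ] F = ⊥
⋃[ inside  ∷ S ] F = F Fin.zero ∪ ⋃[ S ] (F ∘ Fin.suc)
⋃[ outside ∷ S ] F = ⋃[ S ] (F ∘ Fin.suc)

∈⋃⁺ : ∀ {m n} {S : Subset m} {F : Fin m → Subset n} {w x} →
  w ∈ S → x ∈ F w → x ∈ ⋃[ S ] F
∈⋃⁺ {S = inside  ∷ S} here       x∈Fw = x∈p∪q⁺ (inj₁ x∈Fw)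
∈⋃⁺ {S = inside  ∷ S} (there w∈S) x∈Fw = x∈p∪q⁺ (inj₂ (∈⋃⁺ w∈S x∈Fw))
∈⋃⁺ {S = outside ∷ S} (there w∈S) x∈Fw = ∈⋃⁺ w∈S x∈Fw

∈⋃⁻ : ∀ {m n} (S : Subset m) (F : Fin m → Subset n) {x} →
  x ∈ ⋃[ S ] F → ∃ λ w → w ∈ S × x ∈ F w
∈⋃⁻ []            F x∈⋃ = ⊥-elim (∉⊥ x∈⋃)
∈⋃⁻ (inside  ∷ S) F x∈⋃ with x∈p∪q⁻ (F Fin.zero) (⋃[ S ] (F ∘ Fin.suc)) x∈⋃
... | inj₁ x∈F0 = Fin.zero , here , x∈F0
... | inj₂ x∈⋃S = let (w , w∈S , x∈Fw) = ∈⋃⁻ S (F ∘ Fin.suc) x∈⋃S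
                  in Fin.suc w , there w∈S , x∈Fw
∈⋃⁻ (outside ∷ S) F x∈⋃ = let (w , w∈S , x∈Fw) = ∈⋃⁻ S (F ∘ Fin.suc) x∈⋃
                          in Fin.suc w , there w∈S , x∈Fw

∩-distribˡ-⋃ : ∀ {m n} (p : Subset n) (S : Subset m) (F : Fin m → Subset n) →
  p ∩ ⋃[ S ] F ≡ ⋃[ S ] (λ w → p ∩ F w)
∩-distribˡ-⋃ p []            F = ∩-zeroʳ p
∩-distribˡ-⋃ p (inside  ∷ S) F =
  trans (∩-distribˡ-∪ p (F Fin.zero) _)
        (cong (p ∩ F Fin.zero ∪_) (∩-distribˡ-⋃ p S (F ∘ Fin.suc)))
∩-distribˡ-⋃ p (outside ∷ S) F = ∩-distribˡ-⋃ p S (F ∘ Fin.suc)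

∣⋃∣≤ : ∀ {m n} (S : Subset m) (F : Fin m → Subset n) {N} →
  (∀ {w} → w ∈ S → ∣ F w ∣ ≤ N) → ∣ ⋃[ S ] F ∣ ≤ ∣ S ∣ * N
∣⋃∣≤ {n = n} []   F bound = ≤-reflexive (∣⊥∣≡0 n)
∣⋃∣≤ (inside  ∷ S) F bound =
  ≤-trans (∣p∪q∣≤∣p∣+∣q∣ (F Fin.zero) _)
          (+-mono-≤ (bound here) (∣⋃∣≤ S (F ∘ Fin.suc) (bound ∘ there)))
∣⋃∣≤ (outside ∷ S) F bound = ∣⋃∣≤ S (F ∘ Fin.suc) (bound ∘ there)

∣∩⋃∣≤ : ∀ {m n} (p : Subset n) (S : Subset m) (F : Fin m → Subset n) {N} →
  (∀ {w} → w ∈ S → ∣ p ∩ F w ∣ ≤ N) → ∣ p ∩ ⋃[ S ] F ∣ ≤ ∣ S ∣ * N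
∣∩⋃∣≤ p S F bound =
  ≤-trans (≤-reflexive (cong ∣_∣ (∩-distribˡ-⋃ p S F))) (∣⋃∣≤ S (λ w → p ∩ F w) bound)

module _ {n : ℕ} (G : Graph n) where

  dist-mono : ∀ {a b u v} → a ≤ b → DistAtMost G a u v → DistAtMost G b u v
  dist-mono _         here       = here
  dist-mono (s≤s a≤b) (step e p) = step e (dist-mono a≤b p)

  dist-trans : ∀ {a b u w v} →
    DistAtMost G a u w → DistAtMost G b w v → DistAtMost G (a + b) u v
  dist-trans {a} {b} here q = dist-mono (m≤n+m b a) q
  dist-trans (step e p) q   = step e (dist-trans p q)

  dist-snoc : ∀ {k u w v} →
    DistAtMost G k u w → adj G w v ≡ true → DistAtMost G (suc k) u v
  dist-snoc here        e = step e here
  dist-snoc (step e′ p) e = step e′ (dist-snoc p e)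

  dist-sym : ∀ {k u v} → DistAtMost G k u v → DistAtMost G k v u
  dist-sym here                      = here
  dist-sym {u = u} (step {w = w} e p) = dist-snoc (dist-sym p) (trans (adj-sym G w u) e)

  neighbours : Fin n → Subset n
  neighbours v = tabulate (adj G v)

  adj⇒∈neighbours : ∀ {v w} → adj G v w ≡ true → w ∈ neighbours v
  adj⇒∈neighbours {v} {w} e = lookup⇒[]= w _ (trans (lookup∘tabulate (adj G v) w) e)

  ∈neighbours⇒adj : ∀ {v w} → w ∈ neighbours v → adj G v w ≡ true
  ∈neighbours⇒adj {v} {w} w∈N = trans (sym (lookup∘tabulate (adj G v) w)) ([]=⇒lookup w∈N)

  -- The ball of radius k around v, built by the recursion the growth bound
  -- follows: a centre plus the balls of radius k-1 around its neighbours.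
  ball : ℕ → Fin n → Subset n
  ball zero    v = ⁅ v ⁆
  ball (suc k) v = ⁅ v ⁆ ∪ ⋃[ neighbours v ] (ball k)

  ball-complete : ∀ {k v u} → DistAtMost G k v u → u ∈ ball k v
  ball-complete {zero}  here       = x∈⁅x⁆ _
  ball-complete {suc k} here       = x∈p∪q⁺ (inj₁ (x∈⁅x⁆ _))
  ball-complete (step e p) = x∈p∪q⁺ (inj₂ (∈⋃⁺ (adj⇒∈neighbours e) (ball-complete p)))

  ball-sound : ∀ k v {u} → u ∈ ball k v → DistAtMost G k v u
  ball-sound zero v u∈ rewrite x∈⁅y⁆⇒x≡y v u∈ = here
  ball-sound (suc k) v u∈ with x∈p∪q⁻ ⁅ v ⁆ (⋃[ neighbours v ] (ball k)) u∈
  ... | inj₁ u∈⁅v⁆ rewrite x∈⁅y⁆⇒x≡y v u∈⁅v⁆ = here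
  ... | inj₂ u∈⋃ with ∈⋃⁻ (neighbours v) (ball k) u∈⋃
  ... | w , w∈N , u∈ball = step (∈neighbours⇒adj w∈N) (ball-sound k w u∈ball)

  module _ (K : Subset n) where

    ball-growth : ∀ {Δ} → MaxDegreeAtMost G Δ → ∀ m N →
      (∀ w → ∣ K ∩ ball m w ∣ ≤ N) → ∀ v → ∣ K ∩ ball (suc m) v ∣ ≤ 1 + Δ * N
    ball-growth {Δ} maxdeg m N bound v = begin
      ∣ K ∩ (⁅ v ⁆ ∪ ⋃[ neighbours v ] (ball m)) ∣
        ≡⟨ cong ∣_∣ (∩-distribˡ-∪ K ⁅ v ⁆ _) ⟩
      ∣ K ∩ ⁅ v ⁆ ∪ K ∩ ⋃[ neighbours v ] (ball m) ∣
        ≤⟨ ∣p∪q∣≤∣p∣+∣q∣ (K ∩ ⁅ v ⁆) (K ∩ ⋃[ neighbours v ] (ball m)) ⟩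
      ∣ K ∩ ⁅ v ⁆ ∣ + ∣ K ∩ ⋃[ neighbours v ] (ball m) ∣
        ≤⟨ +-mono-≤ centre (∣∩⋃∣≤ K (neighbours v) (ball m) (λ {w} _ → bound w)) ⟩
      1 + degree G v * N
        ≤⟨ +-monoʳ-≤ 1 (*-monoˡ-≤ N (maxdeg v)) ⟩
      1 + Δ * N ∎
      where
        open ≤-Reasoning
        centre : ∣ K ∩ ⁅ v ⁆ ∣ ≤ 1
        centre = ≤-trans (∣p∩q∣≤∣q∣ K ⁅ v ⁆) (≤-reflexive (∣⁅x⁆∣≡1 v))

    ball-packing : ∀ d r → Scattered G d K → r + r ≤ d ∸ 1 →
      ∀ v → ∣ K ∩ ball r v ∣ ≤ 1
    ball-packing d r scattered 2r≤d-1 v = subsingleton⇒∣p∣≤1 (K ∩ ball r v) unique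
      where
        unique : ∀ {x y} → x ∈ K ∩ ball r v → y ∈ K ∩ ball r v → x ≡ y
        unique {x} {y} x∈ y∈ =
          let (x∈K , x∈B) = x∈p∩q⁻ K (ball r v) x∈
              (y∈K , y∈B) = x∈p∩q⁻ K (ball r v) y∈
              close = dist-mono 2r≤d-1
                        (dist-trans (dist-sym (ball-sound r v x∈B)) (ball-sound r v y∈B))
          in decidable-stable (x ≟ y) (λ x≢y → scattered x y x∈K y∈K x≢y close)

    ball-bound : ∀ {Δ} d r → MaxDegreeAtMost G Δ → Scattered G d K → r + r ≤ d ∸ 1 →
      ∀ k v → ∣ K ∩ ball (r + k) v ∣ ≤ (1 + Δ) ^ k
    ball-bound d r maxdeg scattered 2r≤d-1 zero v
      rewrite +-identityʳ r = ball-packing d r scattered 2r≤d-1 v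
    ball-bound {Δ} d r maxdeg scattered 2r≤d-1 (suc k) v
      rewrite +-suc r k =
        ≤-trans (ball-growth maxdeg (r + k) X (ball-bound d r maxdeg scattered 2r≤d-1 k) v)
                (+-monoˡ-≤ (Δ * X) (m^n>0 (1 + Δ) k))
      where
        X = (1 + Δ) ^ k

    covering-bound : ∀ {e N} (vs : List (Fin n)) →
      (∀ v → ∃ λ i → DistAtMost G e (List.lookup vs i) v) →
      (∀ v → ∣ K ∩ ball e v ∣ ≤ N) → ∣ K ∣ ≤ length vs * N
    covering-bound {e} {N} vs covered bound = begin
      ∣ K ∣                   ≤⟨ p⊆q⇒∣p∣≤∣q∣ K⊆K∩⋃ ⟩
      ∣ K ∩ ⋃[ ⊤ ] balls ∣    ≤⟨ ∣∩⋃∣≤ K ⊤ balls (λ {i} _ → bound (List.lookup vs i)) ⟩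
      ∣ ⊤ {length vs} ∣ * N   ≡⟨ cong (_* N) (∣⊤∣≡n (length vs)) ⟩
      length vs * N           ∎
      where
        open ≤-Reasoning
        balls : Fin (length vs) → Subset n
        balls i = ball e (List.lookup vs i)
        K⊆K∩⋃ : K ⊆ K ∩ ⋃[ ⊤ ] balls
        K⊆K∩⋃ {x} x∈K = x∈p∩q⁺ (x∈K , ∈⋃⁺ {S = ⊤} {F = balls} ∈⊤ (ball-complete (proj₂ (covered x))))

  greedy-bound : ∀ {Δ} e → MaxDegreeAtMost G Δ → ∀ vs → GreedyRun G (suc e) vs →
    ∀ K → Scattered G (suc e) K → ∣ K ∣ ≤ length vs * (1 + Δ) ^ (suc e / 2)
  greedy-bound {Δ} e maxdeg vs (_ , covered) K scattered =
    covering-bound K vs covered ball-bound-e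
    where
      ball-bound-e : ∀ v → ∣ K ∩ ball e v ∣ ≤ (1 + Δ) ^ (suc e / 2)
      ball-bound-e v = subst (λ ρ → ∣ K ∩ ball ρ v ∣ ≤ (1 + Δ) ^ (suc e / 2))
                             (radius-split e)
                             (ball-bound K (suc e) ⌊ e /2⌋ maxdeg scattered
                                         (packing-radius e) (suc e / 2) v)

theorem4 : ∀ (d : ℕ) → 2 ≤ d →
    ∃ λ (C : ℕ) →
    ∀ (Δ : ℕ) → 1 ≤ Δ →
    ∀ (n : ℕ) (G : Graph n) → MaxDegreeAtMost G Δ →
    ∀ (vs : List _) → GreedyRun G d vs →
    ∀ (K : Subset n) → Scattered G d K →
    ∣ K ∣ ≤ length vs * (C * Δ ^ (d / 2))
theorem4 zero    ()
theorem4 (suc e) _ = 2 ^ (suc e / 2) , λ Δ 1≤Δ n G maxdeg vs run K scattered →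
  ≤-trans (greedy-bound G e maxdeg vs run K scattered)
          (*-monoʳ-≤ (length vs) ([1+Δ]^k≤2^k*Δ^k 1≤Δ (suc e / 2)))
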